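{- Let $\Gamma$ be a finite Abelian group with $|\Gamma|\ge 3$ and let $g\in\Gamma\setminus\{0\}$. Let $G$ be a graph in which every non-pendant vertex is a weak support vertex. Then $G$ is $\Gamma$-vertex magic with magic constant $g$ if and only if $\deg(x)\not\equiv 2\pmod{o(g)}$ for every $x\in\Omega_{\mathfrak{w}}(G)$.
   Context: Graphs are finite, simple and undirected; $o(g)$ is the order of $g$. For an additive Abelian group $\Gamma$ with identity $0$ and a graph $G$, a $\Gamma$-vertex magic labeling is a map $\ell:V(G)\to\Gamma\setminus\{0\}$ for which there is $\mu\in\Gamma$ (the magic constant) with $w(v)=\sum_{u\in N(v)}\ell(u)=\mu$ for every vertex $v$. A pendant vertex has degree $1$; a weak support vertex is a vertex adjacent to exactly one pendant vertex; $\Omega_{\mathfrak{w}}(G)$ is the set of weak support vertices. -}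

module Defs where

open import Level using (Level; _⊔_)
open import Algebra.Bundles using (AbelianGroup)
open import Data.Bool using (Bool; true; false; if_then_else_)
open import Data.Nat using (ℕ; zero; suc; _<_)
open import Data.Fin using (Fin)
open import Data.List using (List; foldr; allFin)
open import Data.List.Relation.Unary.Any using (Any)
open import Data.Product using (Σ; _×_)
open import Relation.Binary.PropositionalEquality using (_≡_)
open import Relation.Nullary using (¬_)

record Graph (n : ℕ) : Set where
  field
    Adj   : Fin n → Fin n → Bool
    sym   : ∀ u v → Adj u v ≡ Adj v u
    irrefl : ∀ v → Adj v v ≡ false

module _ {n : ℕ} (G : Graph n) where
  open Graph G

  count : (Fin n → Bool) → ℕ
  count p = foldr (λ u acc → if p u then suc acc else acc) 0 (allFin n)

  deg : Fin n → ℕ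
  deg v = count (Adj v)

  isPendantᵇ : Fin n → Bool
  isPendantᵇ v with deg v
  ... | 1 = true
  ... | _ = false

  IsPendant : Fin n → Set
  IsPendant v = deg v ≡ 1

  pendantNeighbours : Fin n → ℕ
  pendantNeighbours v = count (λ u → if Adj v u then isPendantᵇ u else false)

  IsWeakSupport : Fin n → Set
  IsWeakSupport v = pendantNeighbours v ≡ 1

module _ {c ℓ : Level} (Γ : AbelianGroup c ℓ) where
  open AbelianGroup Γ renaming (Carrier to A)

  _·_ : ℕ → A → A
  zero  · x = ε
  suc k · x = x ∙ (k · x)

  IsFinite : Set (c ⊔ ℓ)
  IsFinite = Σ (List A) λ xs → ∀ a → Any (a ≈_) xs

  AtLeast3 : Set (c ⊔ ℓ)
  AtLeast3 = Σ A λ a → Σ A λ b → Σ A λ d → ¬ a ≈ b × ¬ a ≈ d × ¬ b ≈ d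

  IsOrder : A → ℕ → Set ℓ
  IsOrder g k = 0 < k × (k · g) ≈ ε × (∀ j → 0 < j → j < k → ¬ (j · g) ≈ ε)

  module _ {n : ℕ} (G : Graph n) where
    open Graph G

    weight : (Fin n → A) → Fin n → A
    weight lab v = foldr (λ u acc → if Adj v u then lab u ∙ acc else acc) ε (allFin n)

    IsVertexMagicLabeling : (Fin n → A) → A → Set ℓ
    IsVertexMagicLabeling lab μ = (∀ v → ¬ lab v ≈ ε) × (∀ v → weight lab v ≈ μ)

    IsVertexMagicWith : A → Set (c ⊔ ℓ)
    IsVertexMagicWith μ = Σ (Fin n → A) λ lab → IsVertexMagicLabeling lab μ

{-# OPTIONS --safe #-}
-- In a magic labeling with constant g the weight of a pendant vertex is the label of its
-- neighbour, so every vertex next to a pendant vertex is labelled g; by hypothesis this covers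
-- every non-pendant vertex. A non-pendant x of degree m + 2 then has one pendant neighbour p and
-- m + 1 neighbours labelled g, forcing ℓ(p) = g - (m + 1) g = -(m g), which is nonzero exactly
-- when o(g) ∤ m = deg x - 2; a pendant weak support vertex has deg x - 2 = -1 and o(g) ≠ 1.
-- Conversely, g on non-pendant vertices and g - (deg x - 1) g on a pendant vertex with
-- neighbour x is a magic labeling.
module Submission where

open import Defs hiding (_·_)
open import Algebra.Bundles using (AbelianGroup; CommutativeMonoid)
open import Data.Nat using (ℕ)
open import Data.Fin using (Fin)
open import Data.Integer using (+_; _-_)
open import Data.Integer.Divisibility using (_∣_)
open import Function.Bundles using (_⇔_; mk⇔; Equivalence)
open import Function.Construct.Composition using (_⇔-∘_)
open import Relation.Nullary using (¬_)

open import Data.Bool using (Bool; true; false; if_then_else_; not)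
open import Data.Bool.Properties using (not-¬)
open import Data.Empty using (⊥-elim)
open import Data.Integer using (∣_∣)
open import Data.List using (List; []; _∷_; foldr; allFin)
open import Data.List.Membership.Propositional using (_∈_)
open import Data.List.Membership.Propositional.Properties using (∈-allFin)
open import Data.List.Relation.Unary.Any using (here; there)
open import Data.Nat using (zero; suc; _+_; _*_; _∸_; _<_; z<s; _≟_; >-nonZero)
import Data.Nat.Divisibility as ℕ
open import Data.Nat.DivMod using (_%_; _/_; m≡m%n+[m/n]*n; m%n<n)
open import Data.Nat.Properties using (suc-injective; +-suc)
open import Data.Product using (∃-syntax; _×_; _,_; proj₁; proj₂)
open import Function using (_∘_)
open import Relation.Nullary using (Dec; yes; no; contraposition)
open import Relation.Binary.PropositionalEquality as ≡ using (_≡_; refl; cong; subst)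

module _ {X : Set} where

  _∩_ : (X → Bool) → (X → Bool) → X → Bool
  (q ∩ r) u = if q u then r u else false

  ∩-true : ∀ (q r : X → Bool) u → (q ∩ r) u ≡ true → q u ≡ true × r u ≡ true
  ∩-true q r u qr with q u
  ... | true = refl , qr

  countWhere : (X → Bool) → List X → ℕ
  countWhere q = foldr (λ u k → if q u then suc k else k) 0

  countWhere-split : ∀ q r xs →
    countWhere q xs ≡ countWhere (q ∩ r) xs + countWhere (q ∩ (not ∘ r)) xs
  countWhere-split q r [] = refl
  countWhere-split q r (y ∷ xs) with q y | r y
  ... | false | _     = countWhere-split q r xs
  ... | true  | true  = cong suc (countWhere-split q r xs)
  ... | true  | false = ≡.trans (cong suc (countWhere-split q r xs)) (≡.sym (+-suc _ _))

  countWhere≡0⇒rejects : ∀ q {xs u} → countWhere q xs ≡ 0 → u ∈ xs → ¬ q u ≡ true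
  countWhere≡0⇒rejects q {y ∷ xs} c (here refl) qy with q y
  countWhere≡0⇒rejects q {y ∷ xs} () (here refl) refl | true
  countWhere≡0⇒rejects q {y ∷ xs} c (there u∈xs) qu with q y
  ... | false = countWhere≡0⇒rejects q c u∈xs qu

  countWhere≢0⇒selects : ∀ q xs {k} → countWhere q xs ≡ suc k → ∃[ u ] q u ≡ true
  countWhere≢0⇒selects q (y ∷ xs) c with q y in qy
  ... | true  = y , qy
  ... | false = countWhere≢0⇒selects q xs c

module Sums {c ℓ} (M : CommutativeMonoid c ℓ) where
  open CommutativeMonoid M
    renaming (Carrier to A; refl to ≈-refl; sym to ≈-sym; trans to ≈-trans)
  open import Algebra.Properties.Monoid.Mult monoid using () renaming (_×_ to _·_)
  open import Algebra.Properties.CommutativeSemigroup commutativeSemigroup using (x∙yz≈y∙xz)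

  sumWhere : {X : Set} → (X → Bool) → (X → A) → List X → A
  sumWhere q f = foldr (λ u s → if q u then f u ∙ s else s) ε

  module _ {X : Set} (f : X → A) where

    sumWhere-split : ∀ q r xs →
      sumWhere q f xs ≈ sumWhere (q ∩ r) f xs ∙ sumWhere (q ∩ (not ∘ r)) f xs
    sumWhere-split q r [] = ≈-sym (identityˡ ε)
    sumWhere-split q r (y ∷ xs) with q y | r y
    ... | false | _     = sumWhere-split q r xs
    ... | true  | true  = ≈-trans (∙-congˡ (sumWhere-split q r xs)) (≈-sym (assoc _ _ _))
    ... | true  | false = ≈-trans (∙-congˡ (sumWhere-split q r xs)) (x∙yz≈y∙xz _ _ _)

    sumWhere-const : ∀ q d → (∀ u → q u ≡ true → f u ≈ d) →
      ∀ xs → sumWhere q f xs ≈ countWhere q xs · d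
    sumWhere-const q d f≈d [] = ≈-refl
    sumWhere-const q d f≈d (y ∷ xs) with q y in qy
    ... | true  = ∙-cong (f≈d y qy) (sumWhere-const q d f≈d xs)
    ... | false = sumWhere-const q d f≈d xs

    sumWhere-empty : ∀ q xs → countWhere q xs ≡ 0 → sumWhere q f xs ≈ ε
    sumWhere-empty q [] c = ≈-refl
    sumWhere-empty q (y ∷ xs) c with q y
    ... | false = sumWhere-empty q xs c

    sumWhere-single : ∀ q {xs u} → countWhere q xs ≡ 1 → u ∈ xs → q u ≡ true →
      sumWhere q f xs ≈ f u
    sumWhere-single q {y ∷ xs} c (here refl) qy rewrite qy =
      ≈-trans (∙-congˡ (sumWhere-empty q xs (suc-injective c))) (identityʳ (f y))
    sumWhere-single q {y ∷ xs} c (there u∈xs) qu with q y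
    ... | true  = ⊥-elim (countWhere≡0⇒rejects q (suc-injective c) u∈xs qu)
    ... | false = sumWhere-single q c u∈xs qu

module Multiples {c ℓ} (Γ : AbelianGroup c ℓ) where
  open AbelianGroup Γ
    renaming (Carrier to A; refl to ≈-refl; sym to ≈-sym; trans to ≈-trans; reflexive to ≈-reflexive)
  open import Algebra.Properties.AbelianGroup Γ using (identityʳ-unique; x∙y⁻¹≈ε⇒x≈y)
  open import Algebra.Properties.Monoid.Mult monoid using (×-homo-+; ×-assocˡ; ×-congʳ)
  open import Algebra.Properties.Monoid.Mult monoid public using () renaming (_×_ to _·_)
  open import Relation.Binary.Reasoning.Setoid setoid

  Defs·≡· : ∀ k x → Defs._·_ Γ k x ≡ k · x
  Defs·≡· zero    x = refl
  Defs·≡· (suc k) x = cong (x ∙_) (Defs·≡· k x)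

  ·-ε : ∀ q → q · ε ≈ ε
  ·-ε zero    = ≈-refl
  ·-ε (suc q) = ≈-trans (identityˡ _) (·-ε q)

  ·≈ε⇒suc·≈ : ∀ m x → m · x ≈ ε → suc m · x ≈ x
  ·≈ε⇒suc·≈ m x m·x≈ε = ≈-trans (∙-congˡ m·x≈ε) (identityʳ x)

  x∙[suc·x]⁻¹≈ε⇒·≈ε : ∀ m x → x ∙ (suc m · x) ⁻¹ ≈ ε → m · x ≈ ε
  x∙[suc·x]⁻¹≈ε⇒·≈ε m x e = identityʳ-unique x (m · x) (≈-sym (x∙y⁻¹≈ε⇒x≈y x _ e))

  module Order {g : A} {k : ℕ} (ord : IsOrder Γ g k) where
    private instance
      k≢0 = >-nonZero (proj₁ ord)

    k·g≈ε : k · g ≈ ε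
    k·g≈ε = ≈-trans (≈-reflexive (≡.sym (Defs·≡· k g))) (proj₁ (proj₂ ord))

    remainder≡0 : ∀ r → r < k → r · g ≈ ε → r ≡ 0
    remainder≡0 zero    _   _     = refl
    remainder≡0 (suc r) r<k r·g≈ε =
      ⊥-elim (proj₂ (proj₂ ord) (suc r) z<s r<k (≈-trans (≈-reflexive (Defs·≡· (suc r) g)) r·g≈ε))

    ∣⇒·≈ε : ∀ m → k ℕ.∣ m → m · g ≈ ε
    ∣⇒·≈ε m (ℕ.divides q refl) = ≈-trans (≈-sym (×-assocˡ g q k)) (≈-trans (×-congʳ q k·g≈ε) (·-ε q))

    ·≈ε⇒∣ : ∀ m → m · g ≈ ε → k ℕ.∣ m
    ·≈ε⇒∣ m m·g≈ε = ℕ.m%n≡0⇒n∣m m k (remainder≡0 (m % k) (m%n<n m k) r·g≈ε)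
      where
      r·g≈ε : (m % k) · g ≈ ε
      r·g≈ε = begin
        (m % k) · g                      ≈⟨ identityʳ _ ⟨
        (m % k) · g ∙ ε                  ≈⟨ ∙-congˡ (∣⇒·≈ε ((m / k) * k) (ℕ.n∣m*n (m / k))) ⟨
        (m % k) · g ∙ ((m / k) * k) · g  ≈⟨ ×-homo-+ g (m % k) _ ⟨
        (m % k + (m / k) * k) · g        ≡⟨ cong (_· g) (m≡m%n+[m/n]*n m k) ⟨
        m · g                            ≈⟨ m·g≈ε ⟩
        ε                                ∎

    ∣⇔·≈ε : ∀ m → k ℕ.∣ m ⇔ m · g ≈ ε
    ∣⇔·≈ε m = mk⇔ (∣⇒·≈ε m) (·≈ε⇒∣ m)

-- Leaves are the pendant vertices; all other vertices are called inner.
module Pendants {n : ℕ} (G : Graph n) where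
  open Graph G using (Adj)

  isPendant? : ∀ u → Dec (IsPendant G u)
  isPendant? u = deg G u ≟ 1

  isPendantᵇ⇒IsPendant : ∀ u → isPendantᵇ G u ≡ true → IsPendant G u
  isPendantᵇ⇒IsPendant u b with deg G u
  ... | 1 = refl

  IsPendant⇒isPendantᵇ : ∀ u → IsPendant G u → isPendantᵇ G u ≡ true
  IsPendant⇒isPendantᵇ u p rewrite p = refl

  adj-sym : ∀ {x y} → Adj x y ≡ true → Adj y x ≡ true
  adj-sym {x} {y} a = ≡.trans (Graph.sym G y x) a

  pendant-neighbour : ∀ {x} → IsPendant G x → ∃[ y ] Adj x y ≡ true
  pendant-neighbour {x} = countWhere≢0⇒selects (Adj x) (allFin n)

  adjLeaf adjInner : Fin n → Fin n → Bool
  adjLeaf  x = Adj x ∩ isPendantᵇ G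
  adjInner x = Adj x ∩ (not ∘ isPendantᵇ G)

  adjLeaf-intro : ∀ {x u} → Adj x u ≡ true → IsPendant G u → adjLeaf x u ≡ true
  adjLeaf-intro {x} {u} a p rewrite a = IsPendant⇒isPendantᵇ u p

  adjInner⇒inner : ∀ x u → adjInner x u ≡ true → ¬ IsPendant G u
  adjInner⇒inner x u a p =
    not-¬ refl (≡.trans (IsPendant⇒isPendantᵇ u p) (≡.sym (proj₂ (∩-true (Adj x) (not ∘ isPendantᵇ G) u a))))

  deg≡leaves+inner : ∀ x → deg G x ≡ pendantNeighbours G x + countWhere (adjInner x) (allFin n)
  deg≡leaves+inner x = countWhere-split (Adj x) (isPendantᵇ G) (allFin n)

  record InnerSupport (x : Fin n) : Set where
    field
      isWeakSupport : IsWeakSupport G x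
      leaf          : Fin n
      adj-leaf      : Adj x leaf ≡ true
      leaf-pendant  : IsPendant G leaf
      excess        : ℕ
      deg≡2+excess  : deg G x ≡ 2 + excess
      innerNeighbours≡ : countWhere (adjInner x) (allFin n) ≡ suc excess

  innerSupport : ∀ {x} → IsWeakSupport G x → ¬ IsPendant G x → InnerSupport x
  innerSupport {x} ws np with countWhere≢0⇒selects (adjLeaf x) (allFin n) ws
  ... | p , xp with countWhere (adjInner x) (allFin n) in inner≡ | deg≡leaves+inner x
  ... | zero  | deg≡ = ⊥-elim (np (≡.trans deg≡ (cong (_+ 0) ws)))
  ... | suc m | deg≡ = record
    { isWeakSupport = ws
    ; leaf = p
    ; adj-leaf = proj₁ (∩-true (Adj x) (isPendantᵇ G) p xp)
    ; leaf-pendant = isPendantᵇ⇒IsPendant p (proj₂ (∩-true (Adj x) (isPendantᵇ G) p xp))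
    ; excess = m
    ; deg≡2+excess = ≡.trans deg≡ (cong (_+ suc m) ws)
    ; innerNeighbours≡ = inner≡
    }

  ∣deg-2∣≡excess : ∀ {x} (s : InnerSupport x) → ∣ (+ deg G x) - (+ 2) ∣ ≡ InnerSupport.excess s
  ∣deg-2∣≡excess s = cong (λ d → ∣ (+ d) - (+ 2) ∣) (InnerSupport.deg≡2+excess s)

module Weights {c ℓ} (Γ : AbelianGroup c ℓ) {n : ℕ} (G : Graph n) where
  open AbelianGroup Γ
    using (_≈_; _∙_; ∙-cong; setoid; commutativeMonoid) renaming (Carrier to A)
  open Sums commutativeMonoid
  open Multiples Γ using (_·_)
  open Pendants G
  open InnerSupport
  open Graph G using (Adj)
  open import Relation.Binary.Reasoning.Setoid setoid

  weight-pendant : ∀ (lab : Fin n → A) {x y} → IsPendant G x → Adj x y ≡ true →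
    weight Γ G lab x ≈ lab y
  weight-pendant lab {x} {y} px = sumWhere-single lab (Adj x) px (∈-allFin y)

  weight-innerSupport : ∀ (lab : Fin n → A) {g x} (s : InnerSupport x) →
    (∀ u → ¬ IsPendant G u → lab u ≈ g) → weight Γ G lab x ≈ lab (leaf s) ∙ suc (excess s) · g
  weight-innerSupport lab {g} {x} s inner≈g = begin
    weight Γ G lab x
      ≈⟨ sumWhere-split lab (Adj x) (isPendantᵇ G) (allFin n) ⟩
    sumWhere (adjLeaf x) lab (allFin n) ∙ sumWhere (adjInner x) lab (allFin n)
      ≈⟨ ∙-cong leaves≈ inner≈ ⟩
    lab (leaf s) ∙ countWhere (adjInner x) (allFin n) · g
      ≡⟨ cong (λ j → lab (leaf s) ∙ j · g) (innerNeighbours≡ s) ⟩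
    lab (leaf s) ∙ suc (excess s) · g ∎
    where
    leaves≈ : sumWhere (adjLeaf x) lab (allFin n) ≈ lab (leaf s)
    leaves≈ = sumWhere-single lab (adjLeaf x) (isWeakSupport s) (∈-allFin (leaf s))
                (adjLeaf-intro (adj-leaf s) (leaf-pendant s))
    inner≈ : sumWhere (adjInner x) lab (allFin n) ≈ countWhere (adjInner x) (allFin n) · g
    inner≈ = sumWhere-const lab (adjInner x) g (λ u a → inner≈g u (adjInner⇒inner x u a)) (allFin n)

module VertexMagic {c ℓ} (Γ : AbelianGroup c ℓ) (g : AbelianGroup.Carrier Γ)
  (g≉ε : ¬ AbelianGroup._≈_ Γ g (AbelianGroup.ε Γ)) {n : ℕ} (G : Graph n)
  (inner⇒weakSupport : ∀ v → ¬ IsPendant G v → IsWeakSupport G v) where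
  open AbelianGroup Γ
    renaming (Carrier to A; refl to ≈-refl; sym to ≈-sym; trans to ≈-trans)
    hiding (_-_)
  open import Algebra.Properties.AbelianGroup Γ using (identityˡ-unique; ε⁻¹≈ε; //-rightDividesˡ)
  open Multiples Γ using (_·_; ·≈ε⇒suc·≈; x∙[suc·x]⁻¹≈ε⇒·≈ε)
  open Pendants G
  open Weights Γ G
  open InnerSupport
  open Graph G using (Adj)
  open import Relation.Binary.Reasoning.Setoid setoid

  DegreeCondition : Set ℓ
  DegreeCondition = ∀ x → IsWeakSupport G x → ¬ ∣ (+ deg G x) - (+ 2) ∣ · g ≈ ε

  innerSupportOf : ∀ {x} → ¬ IsPendant G x → InnerSupport x
  innerSupportOf {x} np = innerSupport (inner⇒weakSupport x np) np

  module _ {lab : Fin n → A} (magic : IsVertexMagicLabeling Γ G lab g) where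

    magic⇒neighbourOfLeaf≈g : ∀ {p x} → IsPendant G p → Adj p x ≡ true → lab x ≈ g
    magic⇒neighbourOfLeaf≈g {p} pp a = ≈-trans (≈-sym (weight-pendant lab pp a)) (proj₂ magic p)

    magic⇒inner≈g : ∀ u → ¬ IsPendant G u → lab u ≈ g
    magic⇒inner≈g u nu = magic⇒neighbourOfLeaf≈g (leaf-pendant s) (adj-sym (adj-leaf s))
      where s = innerSupportOf nu

  magic⇒degreeCondition : IsVertexMagicWith Γ G g → DegreeCondition
  magic⇒degreeCondition (lab , magic) x _ with isPendant? x
  ... | yes px rewrite px = λ 1·g≈ε → g≉ε (≈-trans (≈-sym (identityʳ g)) 1·g≈ε)
  ... | no nx = λ ∣deg-2∣·g≈ε →
    proj₁ magic (leaf s) (identityˡ-unique (lab (leaf s)) g (begin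
      lab (leaf s) ∙ g
        ≈⟨ ∙-congˡ (·≈ε⇒suc·≈ (excess s) g (subst (λ j → j · g ≈ ε) (∣deg-2∣≡excess s) ∣deg-2∣·g≈ε)) ⟨
      lab (leaf s) ∙ suc (excess s) · g  ≈⟨ weight-innerSupport lab s (magic⇒inner≈g magic) ⟨
      weight Γ G lab x                   ≈⟨ proj₂ magic x ⟩
      g                                  ∎))
    where s = innerSupportOf nx

  predDeg·g : Fin n → A
  predDeg·g v = (deg G v ∸ 1) · g

  -- A leaf p with neighbour x gets g - (deg x - 1) g, which makes the weight of an inner x equal g;
  -- weight predDeg·g p reads off the term of that neighbour without having to choose it.
  canonicalLabel : Fin n → A
  canonicalLabel u = if isPendantᵇ G u then g ∙ weight Γ G predDeg·g u ⁻¹ else g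

  canonical-inner : ∀ u → ¬ IsPendant G u → canonicalLabel u ≈ g
  canonical-inner u nu with isPendantᵇ G u in b
  ... | true  = ⊥-elim (nu (isPendantᵇ⇒IsPendant u b))
  ... | false = ≈-refl

  canonical-leaf : ∀ {p x} → IsPendant G p → Adj p x ≡ true →
    canonicalLabel p ≈ g ∙ ((deg G x ∸ 1) · g) ⁻¹
  canonical-leaf {p} pp a rewrite IsPendant⇒isPendantᵇ p pp =
    ∙-congˡ (⁻¹-cong (weight-pendant predDeg·g pp a))

  canonical-leafOfLeaf : ∀ {p x} → IsPendant G p → Adj p x ≡ true → IsPendant G x → canonicalLabel p ≈ g
  canonical-leafOfLeaf pp a px with canonical-leaf pp a
  ... | label≈ rewrite px = ≈-trans label≈ (≈-trans (∙-congˡ ε⁻¹≈ε) (identityʳ g))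

  canonical-leafOfInner : ∀ {p x} → IsPendant G p → Adj p x ≡ true → (s : InnerSupport x) →
    canonicalLabel p ≈ g ∙ (suc (excess s) · g) ⁻¹
  canonical-leafOfInner pp a s with canonical-leaf pp a
  ... | label≈ rewrite deg≡2+excess s = label≈

  canonical-weight : ∀ x → weight Γ G canonicalLabel x ≈ g
  canonical-weight x with isPendant? x
  ... | no nx = begin
    weight Γ G canonicalLabel x             ≈⟨ weight-innerSupport canonicalLabel s canonical-inner ⟩
    canonicalLabel (leaf s) ∙ suc m · g
      ≈⟨ ∙-congʳ (canonical-leafOfInner (leaf-pendant s) (adj-sym (adj-leaf s)) s) ⟩
    g ∙ (suc m · g) ⁻¹ ∙ suc m · g          ≈⟨ //-rightDividesˡ (suc m · g) g ⟩
    g                                       ∎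
    where
    s = innerSupportOf nx
    m = excess s
  ... | yes px with pendant-neighbour px
  ... | y , a with isPendant? y
  ... | yes py = ≈-trans (weight-pendant canonicalLabel px a) (canonical-leafOfLeaf py (adj-sym a) px)
  ... | no ny  = ≈-trans (weight-pendant canonicalLabel px a) (canonical-inner y ny)

  canonical-nonzero : DegreeCondition → ∀ u → ¬ canonicalLabel u ≈ ε
  canonical-nonzero cond u with isPendant? u
  ... | no nu = g≉ε ∘ ≈-trans (≈-sym (canonical-inner u nu))
  ... | yes pu with pendant-neighbour pu
  ... | v , a with isPendant? v
  ... | yes pv = g≉ε ∘ ≈-trans (≈-sym (canonical-leafOfLeaf pu a pv))
  ... | no nv  = λ label≈ε → cond v (isWeakSupport s)
    (subst (λ j → j · g ≈ ε) (≡.sym (∣deg-2∣≡excess s))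
      (x∙[suc·x]⁻¹≈ε⇒·≈ε (excess s) g (≈-trans (≈-sym (canonical-leafOfInner pu a s)) label≈ε)))
    where s = innerSupportOf nv

  degreeCondition⇒magic : DegreeCondition → IsVertexMagicWith Γ G g
  degreeCondition⇒magic cond = canonicalLabel , canonical-nonzero cond , canonical-weight

  magic⇔degreeCondition : IsVertexMagicWith Γ G g ⇔ DegreeCondition
  magic⇔degreeCondition = mk⇔ magic⇒degreeCondition degreeCondition⇒magic

theorem2p5 : ∀ {c ℓ} (Γ : AbelianGroup c ℓ) → IsFinite Γ → AtLeast3 Γ →
    (g : AbelianGroup.Carrier Γ) → ¬ AbelianGroup._≈_ Γ g (AbelianGroup.ε Γ) →
    (k : ℕ) → IsOrder Γ g k →
    {n : ℕ} (G : Graph n) →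
    (∀ v → ¬ IsPendant G v → IsWeakSupport G v) →
    (IsVertexMagicWith Γ G g ⇔ (∀ x → IsWeakSupport G x → ¬ ((+ k) ∣ ((+ deg G x) - (+ 2)))))
theorem2p5 Γ _ _ g g≉ε k ord G inner⇒weakSupport = divisibilityForm ⇔-∘ magic⇔degreeCondition
  where
  open VertexMagic Γ g g≉ε G inner⇒weakSupport
  open Multiples.Order Γ ord using (∣⇔·≈ε)

  divisibilityForm : DegreeCondition ⇔ (∀ x → IsWeakSupport G x → ¬ ((+ k) ∣ ((+ deg G x) - (+ 2))))
  divisibilityForm = mk⇔
    (λ cond x ws → contraposition (Equivalence.to   (∣⇔·≈ε _)) (cond x ws))
    (λ cond x ws → contraposition (Equivalence.from (∣⇔·≈ε _)) (cond x ws))
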